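{- Let $n\ge 3$ and let $G$ be a graph on $2n$ vertices with at least $n^2-1$ edges such that $G$ contains no two distinct vertices of equal degree joined by a path of length three. Let $\beta$ be the largest integer such that $G$ contains two distinct vertices of degree $\beta$, and let $\Delta$ be the maximum degree of $G$. Then $3\le\beta\le\Delta$.
   Context: Graphs are finite and simple. A path of length three joining $a$ and $b$ is a path $a\,x\,y\,b$ on four distinct vertices with three edges. -}

module Defs where

open import Data.Nat using (ℕ; _+_; _*_; _<_; _≤_; _^_)
open import Data.Fin using (Fin)
import Data.Fin as F
open import Data.Bool using (Bool; true; false; if_then_else_)
open import Data.List using (List; length; filter; allFin; concatMap; map)
open import Data.Product using (Σ; _×_; _,_; ∃; ∃-syntax)
open import Relation.Binary.PropositionalEquality using (_≡_; _≢_)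
open import Relation.Nullary using (¬_)

record Graph (m : ℕ) : Set where
  field
    adj   : Fin m → Fin m → Bool
    sym   : ∀ u v → adj u v ≡ adj v u
    irrefl : ∀ u → adj u u ≡ false
open Graph public

Adj : ∀ {m} → Graph m → Fin m → Fin m → Set
Adj G u v = adj G u v ≡ true

degree : ∀ {m} → Graph m → Fin m → ℕ
degree {m} G u = length (filter (λ v → adj G u v Data.Bool.≟ true) (allFin m))
  where import Data.Bool

edgeCount : ∀ {m} → Graph m → ℕ
edgeCount {m} G =
  length (filter (λ p → Data.Bool._≟_ (adj G (proj₁' p) (proj₂' p)) true)
                 (filter (λ p → proj₁' p F.<? proj₂' p)
                         (concatMap (λ u → map (λ v → u , v) (allFin m)) (allFin m))))
  where
    import Data.Bool
    proj₁' : Fin m × Fin m → Fin m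
    proj₁' (a , _) = a
    proj₂' : Fin m × Fin m → Fin m
    proj₂' (_ , b) = b

PathLen3 : ∀ {m} → Graph m → Fin m → Fin m → Set
PathLen3 G a b = ∃[ x ] ∃[ y ]
  ( a ≢ x × a ≢ y × a ≢ b × x ≢ y × x ≢ b × y ≢ b
  × Adj G a x × Adj G x y × Adj G y b )

NoEqualDegreeP3 : ∀ {m} → Graph m → Set
NoEqualDegreeP3 G = ∀ a b → a ≢ b → degree G a ≡ degree G b → ¬ PathLen3 G a b

RepeatedDegree : ∀ {m} → Graph m → ℕ → Set
RepeatedDegree G d = ∃[ u ] ∃[ v ] (u ≢ v × degree G u ≡ d × degree G v ≡ d)

IsLargestRepeatedDegree : ∀ {m} → Graph m → ℕ → Set
IsLargestRepeatedDegree G β = RepeatedDegree G β × (∀ d → RepeatedDegree G d → d ≤ β)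

IsMaxDegree : ∀ {m} → Graph m → ℕ → Set
IsMaxDegree G Δ = (∃[ u ] degree G u ≡ Δ) × (∀ u → degree G u ≤ Δ)

-- Suppose β ≤ 2: then vertices of degree at least 3 have pairwise distinct
-- degrees, so the excesses d(u) − 2 take distinct values on the vertices where
-- they are positive, and such values bounded by M sum to at most 1 + ⋯ + M.
-- If no vertex is adjacent to all others, every excess is at most 2n − 4 and
-- 2e(G) ≤ 4n + (n − 2)(2n − 3) < 2n² − 2.  If w is adjacent to all others, a
-- vertex v ≠ w of degree at least 3 has, besides w, at most one neighbour of
-- degree at most 2 (two of them, x and y, would be joined by the path x v w y),
-- so the K such vertices would have distinct degrees in {3, …, K + 1}; hence all
-- vertices other than w have degree at most 2 and 2e(G) ≤ 3(2n − 1) < 2n² − 2.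
module Submission where

open import Defs hiding (sym)
import Defs
open import Data.Nat
  using (ℕ; zero; suc; _+_; _*_; _∸_; _≤_; _<_; z≤n; s≤s; s≤s⁻¹; z<s; _<ᵇ_) renaming (_≟_ to _≟ℕ_)
open import Data.Nat.Properties hiding (_≟_; suc-injective)
open import Data.Fin as Fin using (Fin; zero; suc; punchIn)
import Data.Fin.Properties as Finₚ
open import Data.Fin.Properties using (_≟_; any?; punchIn-injective; punchInᵢ≢i; suc-injective)
open import Data.Bool using (Bool; true; false; _∧_; not; if_then_else_)
import Data.Bool as Bool
open import Data.Bool.Properties using (∧-zeroʳ; ∧-conicalˡ; ∧-conicalʳ; not-injective)
open import Data.Product using (_×_; _,_; proj₁; proj₂)
open import Relation.Nullary using (yes; no; does; contradiction)
open import Relation.Binary.PropositionalEquality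
open import Function using (_∘_)
open import Data.Nat.Tactic.RingSolver using (solve-∀)
open import Level using (0ℓ)
open import Relation.Unary using (Pred; Decidable)
open import Relation.Nullary.Decidable using (_×-dec_; dec-true; dec-false)
open import Relation.Binary using (tri<; tri≈; tri>)
import Data.List
open import Data.List using (List; []; _∷_; _++_; length; filter; concat; tabulate; allFin)
open import Data.List.Properties using (filter-++; length-++; map-tabulate)
open import Algebra.Properties.CommutativeMonoid.Sum +-0-commutativeMonoid
  using (sum-syntax; sum-cong-≗; sum-replicate-zero; sum-remove; ∑-distrib-+; ∑-comm)

𝟙 : Bool → ℕ
𝟙 true  = 1
𝟙 false = 0

𝟙≤1 : ∀ b → 𝟙 b ≤ 1
𝟙≤1 true  = ≤-refl
𝟙≤1 false = z≤n

0≮ᵇ⇒≡0 : ∀ {n} → (0 <ᵇ n) ≡ false → n ≡ 0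
0≮ᵇ⇒≡0 {zero} _ = refl

0<ᵇ⇒0< : ∀ {n} → (0 <ᵇ n) ≡ true → 0 < n
0<ᵇ⇒0< {suc n} _ = z<s

𝟙-≤-cases : ∀ a h e → 𝟙 a ≤ 𝟙 h + 𝟙 e + 𝟙 (not e ∧ a ∧ not h)
𝟙-≤-cases false h     e     = z≤n
𝟙-≤-cases true  true  e     = s≤s z≤n
𝟙-≤-cases true  false true  = s≤s z≤n
𝟙-≤-cases true  false false = s≤s z≤n

count : ∀ {m} → (Fin m → Bool) → ℕ
count {m} p = ∑[ i < m ] 𝟙 (p i)

∑-const : ∀ m c → ∑[ i < m ] c ≡ m * c
∑-const zero    c = refl
∑-const (suc m) c = cong (c +_) (∑-const m c)

∑-mono-≤ : ∀ {m} {f g : Fin m → ℕ} → (∀ i → f i ≤ g i) → ∑[ i < m ] f i ≤ ∑[ i < m ] g i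
∑-mono-≤ {zero}  _   = z≤n
∑-mono-≤ {suc m} f≤g = +-mono-≤ (f≤g zero) (∑-mono-≤ (f≤g ∘ suc))

∑-+-≤ : ∀ {m} {f g h : Fin m → ℕ} → (∀ i → f i + g i ≤ h i) →
        ∑[ i < m ] f i + ∑[ i < m ] g i ≤ ∑[ i < m ] h i
∑-+-≤ {f = f} {g} f+g≤h = ≤-trans (≤-reflexive (sym (∑-distrib-+ f g))) (∑-mono-≤ f+g≤h)

count-singleton : ∀ {m} (i : Fin m) → count (λ j → does (j ≟ i)) ≡ 1
count-singleton {suc m} zero    = cong suc (sum-replicate-zero m)
count-singleton {suc m} (suc i) = count-singleton i

count-≤1 : ∀ {m} (p : Fin m → Bool) → (∀ i j → p i ≡ true → p j ≡ true → i ≡ j) → count p ≤ 1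
count-≤1 {zero}  p unique = z≤n
count-≤1 {suc m} p unique with p zero in p0
... | true  = s≤s (≤-reflexive (trans (sum-cong-≗ rest-false) (sum-replicate-zero m)))
  where
  rest-false : ∀ j → 𝟙 (p (suc j)) ≡ 0
  rest-false j with p (suc j) in pj
  ... | false = refl
  ... | true  = contradiction (unique zero (suc j) p0 pj) λ ()
... | false = count-≤1 (p ∘ suc) (λ i j pi pj → suc-injective (unique (suc i) (suc j) pi pj))

sumTo : (ℕ → ℕ) → ℕ → ℕ
sumTo φ zero    = 0
sumTo φ (suc M) = φ (suc M) + sumTo φ M

InjectiveOnPositives : ∀ {m} → (Fin m → ℕ) → Set
InjectiveOnPositives f = ∀ i j → 0 < f i → f i ≡ f j → i ≡ j

-- At most one index takes the value M; remove it and recurse on M.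
∑-injectiveOnPositives-≤ : (φ : ℕ → ℕ) → φ 0 ≡ 0 → ∀ M {m} (f : Fin m → ℕ) →
  (∀ i → f i ≤ M) → InjectiveOnPositives f → ∑[ i < m ] φ (f i) ≤ sumTo φ M
∑-injectiveOnPositives-≤ φ φ0≡0 zero {m} f f≤0 _ = ≤-reflexive (begin
  ∑[ i < m ] φ (f i) ≡⟨ sum-cong-≗ (λ i → trans (cong φ (n≤0⇒n≡0 (f≤0 i))) φ0≡0) ⟩
  ∑[ i < m ] 0       ≡⟨ sum-replicate-zero m ⟩
  0                  ∎)
  where open ≡-Reasoning
∑-injectiveOnPositives-≤ φ φ0≡0 (suc M) {zero} f _ _ = z≤n
∑-injectiveOnPositives-≤ φ φ0≡0 (suc M) {suc m} f f≤ inj with any? (λ i → f i ≟ℕ suc M)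
... | yes (i , fi≡) = begin
  ∑[ j < suc m ] φ (f j)                   ≡⟨ sum-remove {i = i} (φ ∘ f) ⟩
  φ (f i) + ∑[ j < m ] φ (f (punchIn i j)) ≤⟨ +-mono-≤ (≤-reflexive (cong φ fi≡))
                                                (∑-injectiveOnPositives-≤ φ φ0≡0 M (f ∘ punchIn i) below inj-rest) ⟩
  φ (suc M) + sumTo φ M                    ∎
  where
  open ≤-Reasoning
  below : ∀ j → f (punchIn i j) ≤ M
  below j = s≤s⁻¹ (≤∧≢⇒< (f≤ (punchIn i j)) λ fj≡ →
    punchInᵢ≢i i j (inj _ i (subst (0 <_) (sym fj≡) z<s) (trans fj≡ (sym fi≡))))
  inj-rest : InjectiveOnPositives (f ∘ punchIn i)
  inj-rest j k pos eq = punchIn-injective i j k (inj _ _ pos eq)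
... | no none = ≤-trans (∑-injectiveOnPositives-≤ φ φ0≡0 M f below inj) (m≤n+m _ _)
  where
  below : ∀ j → f j ≤ M
  below j = s≤s⁻¹ (≤∧≢⇒< (f≤ j) λ fj≡ → none (j , fj≡))

sumTo-positive : ∀ M → sumTo (λ k → 𝟙 (0 <ᵇ k)) M ≡ M
sumTo-positive zero    = refl
sumTo-positive (suc M) = cong suc (sumTo-positive M)

*-sumTo-id : ∀ j → 2 * sumTo (λ k → k) j ≡ j * suc j
*-sumTo-id zero    = refl
*-sumTo-id (suc j) = begin
  2 * (suc j + sumTo (λ k → k) j)     ≡⟨ *-distribˡ-+ 2 (suc j) _ ⟩
  2 * suc j + 2 * sumTo (λ k → k) j   ≡⟨ cong (2 * suc j +_) (*-sumTo-id j) ⟩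
  2 * suc j + j * suc j               ≡⟨ *-distribʳ-+ (suc j) 2 j ⟨
  (2 + j) * suc j                     ≡⟨ *-comm (2 + j) (suc j) ⟩
  suc j * suc (suc j)                 ∎
  where open ≡-Reasoning

module _ {A : Set} {P : Pred A 0ℓ} (P? : Decidable P) where

  length-filter-tabulate : ∀ {m} (f : Fin m → A) →
    length (filter P? (tabulate f)) ≡ count (λ i → does (P? (f i)))
  length-filter-tabulate {zero}  f = refl
  length-filter-tabulate {suc m} f with does (P? (f zero))
  ... | true  = cong suc (length-filter-tabulate (f ∘ suc))
  ... | false = length-filter-tabulate (f ∘ suc)

  length-filter-concat : ∀ {m} (xss : Fin m → List A) →
    length (filter P? (concat (tabulate xss))) ≡ ∑[ i < m ] length (filter P? (xss i))
  length-filter-concat {zero}  xss = refl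
  length-filter-concat {suc m} xss = begin
    length (filter P? (xss zero ++ rest))              ≡⟨ cong length (filter-++ P? (xss zero) rest) ⟩
    length (filter P? (xss zero) ++ filter P? rest)    ≡⟨ length-++ (filter P? (xss zero)) ⟩
    length (filter P? (xss zero)) + length (filter P? rest)
      ≡⟨ cong (length (filter P? (xss zero)) +_) (length-filter-concat (xss ∘ suc)) ⟩
    ∑[ i < suc m ] length (filter P? (xss i))          ∎
    where
    open ≡-Reasoning
    rest = concat (tabulate (xss ∘ suc))

  filter-filter : {Q : Pred A 0ℓ} (Q? : Decidable Q) (xs : List A) →
    filter Q? (filter P? xs) ≡ filter (λ x → P? x ×-dec Q? x) xs
  filter-filter Q? [] = refl
  filter-filter Q? (x ∷ xs) with does (P? x)
  ... | false = filter-filter Q? xs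
  ... | true with does (Q? x)
  ...   | true  = cong (x ∷_) (filter-filter Q? xs)
  ...   | false = filter-filter Q? xs

does-≟-true : ∀ b → does (b Bool.≟ true) ≡ b
does-≟-true true  = refl
does-≟-true false = refl

module _ {m} (G : Graph m) where

  degree≡count : ∀ u → degree G u ≡ count (adj G u)
  degree≡count u = trans (length-filter-tabulate (λ v → adj G u v Bool.≟ true) (λ v → v))
                         (sum-cong-≗ (λ v → cong 𝟙 (does-≟-true (adj G u v))))

  private
    Below : Fin m → Fin m → Bool
    Below u v = does (u Finₚ.<? v) ∧ adj G u v

    Below? : Decidable (λ (p : Fin m × Fin m) → proj₁ p Fin.< proj₂ p × Adj G (proj₁ p) (proj₂ p))
    Below? (u , v) = (u Finₚ.<? v) ×-dec (adj G u v Bool.≟ true)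

    row : Fin m → List (Fin m × Fin m)
    row u = Data.List.map (u ,_) (allFin m)

  edgeCount≡∑ : edgeCount G ≡ ∑[ u < m ] count (Below u)
  edgeCount≡∑ = begin
    edgeCount G
      ≡⟨ cong length (filter-filter (λ p → proj₁ p Finₚ.<? proj₂ p)
                                    (λ p → adj G (proj₁ p) (proj₂ p) Bool.≟ true)
                                    (concat (Data.List.map row (allFin m)))) ⟩
    length (filter Below? (concat (Data.List.map row (allFin m))))
      ≡⟨ cong (length ∘ filter Below? ∘ concat) (map-tabulate (λ u → u) row) ⟩
    length (filter Below? (concat (tabulate row)))
      ≡⟨ length-filter-concat Below? row ⟩
    ∑[ u < m ] length (filter Below? (row u))
      ≡⟨ sum-cong-≗ (λ u → trans (cong (length ∘ filter Below?) (map-tabulate (λ v → v) (u ,_)))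
                         (trans (length-filter-tabulate Below? (u ,_))
                                (sum-cong-≗ λ v → cong (λ b → 𝟙 (does (u Finₚ.<? v) ∧ b))
                                                       (does-≟-true (adj G u v))))) ⟩
    ∑[ u < m ] count (Below u) ∎
    where open ≡-Reasoning

  private
    𝟙-adj-split : ∀ u v → 𝟙 (adj G u v) ≡ 𝟙 (Below u v) + 𝟙 (Below v u)
    𝟙-adj-split u v with Finₚ.<-cmp u v
    ... | tri< u<v _ v≮u rewrite dec-true (u Finₚ.<? v) u<v | dec-false (v Finₚ.<? u) v≮u =
      sym (+-identityʳ _)
    ... | tri> u≮v _ v<u rewrite dec-false (u Finₚ.<? v) u≮v | dec-true (v Finₚ.<? u) v<u =
      cong 𝟙 (Defs.sym G u v)
    ... | tri≈ _ refl _ rewrite irrefl G u | ∧-zeroʳ (does (u Finₚ.<? u)) = refl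

  handshake : ∑[ u < m ] degree G u ≡ edgeCount G + edgeCount G
  handshake = begin
    ∑[ u < m ] degree G u
      ≡⟨ sum-cong-≗ (λ u → trans (degree≡count u) (sum-cong-≗ (𝟙-adj-split u))) ⟩
    ∑[ u < m ] ∑[ v < m ] (𝟙 (Below u v) + 𝟙 (Below v u))
      ≡⟨ sum-cong-≗ (λ u → ∑-distrib-+ (λ v → 𝟙 (Below u v)) (λ v → 𝟙 (Below v u))) ⟩
    ∑[ u < m ] (count (Below u) + ∑[ v < m ] 𝟙 (Below v u))
      ≡⟨ ∑-distrib-+ (λ u → count (Below u)) (λ u → ∑[ v < m ] 𝟙 (Below v u)) ⟩
    ∑[ u < m ] count (Below u) + ∑[ u < m ] ∑[ v < m ] 𝟙 (Below v u)
      ≡⟨ cong (∑[ u < m ] count (Below u) +_) (∑-comm (λ u v → 𝟙 (Below v u))) ⟩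
    ∑[ u < m ] count (Below u) + ∑[ v < m ] count (Below v)
      ≡⟨ cong₂ _+_ edgeCount≡∑ edgeCount≡∑ ⟨
    edgeCount G + edgeCount G ∎
    where open ≡-Reasoning

  Adj⇒≢ : ∀ {u v} → Adj G u v → u ≢ v
  Adj⇒≢ {u} uv refl = contradiction (trans (sym (irrefl G u)) uv) λ ()

  Adj-sym : ∀ {u v} → Adj G u v → Adj G v u
  Adj-sym {u} {v} uv = trans (Defs.sym G v u) uv

  pathLen3 : ∀ {a x y b} → a ≢ y → a ≢ b → x ≢ b →
             Adj G a x → Adj G x y → Adj G y b → PathLen3 G a b
  pathLen3 a≢y a≢b x≢b ax xy yb =
    _ , _ , Adj⇒≢ ax , a≢y , a≢b , Adj⇒≢ xy , x≢b , Adj⇒≢ yb , ax , xy , yb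

  degree+count-≤ : ∀ u {p : Fin m → Bool} {h : Fin m → ℕ} →
    (∀ v → 𝟙 (adj G u v) + 𝟙 (p v) ≤ h v) → degree G u + count p ≤ ∑[ v < m ] h v
  degree+count-≤ u bound = subst (λ d → d + _ ≤ _) (sym (degree≡count u)) (∑-+-≤ bound)

  degree<order : ∀ u → degree G u < m
  degree<order u = begin
    suc (degree G u)                        ≡⟨ +-comm 1 (degree G u) ⟩
    degree G u + 1                          ≡⟨ cong (degree G u +_) (count-singleton u) ⟨
    degree G u + count (λ v → does (v ≟ u)) ≤⟨ degree+count-≤ u adj+self≤1 ⟩
    ∑[ v < m ] 1                            ≡⟨ trans (∑-const m 1) (*-identityʳ m) ⟩
    m                                       ∎
    where
    open ≤-Reasoning
    adj+self≤1 : ∀ v → 𝟙 (adj G u v) + 𝟙 (does (v ≟ u)) ≤ 1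
    adj+self≤1 v with v ≟ u
    ... | yes refl rewrite irrefl G u = ≤-refl
    ... | no _     = ≤-trans (≤-reflexive (+-identityʳ _)) (𝟙≤1 (adj G u v))

  two-neighbours⇒2≤degree : ∀ {u x y} → x ≢ y → Adj G u x → Adj G u y → 2 ≤ degree G u
  two-neighbours⇒2≤degree {u} {x} {y} x≢y ux uy = begin
    2                                                       ≡⟨ cong₂ _+_ (count-singleton x) (count-singleton y) ⟨
    count (λ v → does (v ≟ x)) + count (λ v → does (v ≟ y)) ≤⟨ ∑-+-≤ x-or-y ⟩
    count (adj G u)                                         ≡⟨ degree≡count u ⟨
    degree G u                                              ∎
    where
    open ≤-Reasoning
    x-or-y : ∀ v → 𝟙 (does (v ≟ x)) + 𝟙 (does (v ≟ y)) ≤ 𝟙 (adj G u v)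
    x-or-y v with v ≟ x | v ≟ y
    ... | yes refl | yes refl = contradiction refl x≢y
    ... | yes refl | no _     rewrite ux = ≤-refl
    ... | no _     | yes refl rewrite uy = ≤-refl
    ... | no _     | no _     = z≤n

  non-adjacent⇒degree+2≤order : ∀ {w v} → v ≢ w → adj G w v ≡ false → degree G w + 2 ≤ m
  non-adjacent⇒degree+2≤order {w} {v} v≢w wv = begin
    degree G w + 2
      ≡⟨ +-assoc (degree G w) 1 1 ⟨
    degree G w + 1 + 1
      ≡⟨ cong₂ (λ a b → degree G w + a + b) (count-singleton w) (count-singleton v) ⟨
    degree G w + count (λ x → does (x ≟ w)) + count (λ x → does (x ≟ v))
      ≤⟨ +-monoˡ-≤ _ (degree+count-≤ w (λ _ → ≤-refl)) ⟩
    ∑[ x < m ] (𝟙 (adj G w x) + 𝟙 (does (x ≟ w))) + count (λ x → does (x ≟ v))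
      ≤⟨ ∑-+-≤ w-or-v ⟩
    ∑[ x < m ] 1
      ≡⟨ trans (∑-const m 1) (*-identityʳ m) ⟩
    m ∎
    where
    open ≤-Reasoning
    w-or-v : ∀ x → 𝟙 (adj G w x) + 𝟙 (does (x ≟ w)) + 𝟙 (does (x ≟ v)) ≤ 1
    w-or-v x with x ≟ w | x ≟ v
    ... | yes refl | yes refl = contradiction refl v≢w
    ... | yes refl | no _     rewrite irrefl G w = ≤-refl
    ... | no _     | yes refl rewrite wv = ≤-refl
    ... | no _     | no _     = ≤-trans (≤-reflexive (trans (+-identityʳ _) (+-identityʳ _))) (𝟙≤1 (adj G w x))

  excess : Fin m → ℕ
  excess u = degree G u ∸ 2

  positive-excess⇒2<degree : ∀ u → 0 < excess u → 2 < degree G u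
  positive-excess⇒2<degree u pos = m∸n≢0⇒n<m (≢-sym (<⇒≢ pos))

RepeatedDegreesAtMost : ∀ {m} → Graph m → ℕ → Set
RepeatedDegreesAtMost G b = ∀ u v → u ≢ v → degree G u ≡ degree G v → degree G u ≤ b

module _ {m} (G : Graph m) (rep≤2 : RepeatedDegreesAtMost G 2) where

  excess-injectiveOnPositives : InjectiveOnPositives (excess G)
  excess-injectiveOnPositives i j pos eq with i ≟ j
  ... | yes i≡j = i≡j
  ... | no  i≢j = contradiction (positive-excess⇒2<degree G i pos)
                    (≤⇒≯ (rep≤2 i j i≢j (∸-cancelʳ-≡ (2≤ i pos) (2≤ j (subst (0 <_) eq pos)) eq)))
    where
    2≤ : ∀ u → 0 < excess G u → 2 ≤ degree G u
    2≤ u = <⇒≤ ∘ positive-excess⇒2<degree G u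

  ∑degree-≤-maxDegree : ∀ M → (∀ u → degree G u ≤ 2 + M) →
                        ∑[ u < m ] degree G u ≤ m * 2 + sumTo (λ k → k) M
  ∑degree-≤-maxDegree M deg≤ = begin
    ∑[ u < m ] degree G u                ≤⟨ ∑-mono-≤ (λ u → m≤n+m∸n (degree G u) 2) ⟩
    ∑[ u < m ] (2 + excess G u)          ≡⟨ ∑-distrib-+ (λ _ → 2) (excess G) ⟩
    ∑[ u < m ] 2 + ∑[ u < m ] excess G u ≤⟨ +-mono-≤ (≤-reflexive (∑-const m 2))
                                              (∑-injectiveOnPositives-≤ (λ k → k) refl M (excess G)
                                                 (λ u → ∸-monoˡ-≤ 2 (deg≤ u)) excess-injectiveOnPositives) ⟩
    m * 2 + sumTo (λ k → k) M            ∎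
    where open ≤-Reasoning

module _ {m} (G : Graph (suc m)) (no-P3 : NoEqualDegreeP3 G) (rep≤2 : RepeatedDegreesAtMost G 2)
         (w : Fin (suc m)) (w-dominating : degree G w ≡ m) where

  private
    w-adj : ∀ {v} → v ≢ w → Adj G w v
    w-adj {v} v≢w with adj G w v in wv
    ... | true  = refl
    ... | false = contradiction
      (subst (_≤ suc m) (trans (cong (_+ 2) w-dominating) (+-comm m 2))
             (non-adjacent⇒degree+2≤order G v≢w wv))
      1+n≰n

    heavyExcess : Fin (suc m) → ℕ
    heavyExcess u = if does (u ≟ w) then 0 else excess G u

    -- heavy u holds iff u ≢ w and degree G u ≥ 3.
    heavy : Fin (suc m) → Bool
    heavy u = 0 <ᵇ heavyExcess u

    K : ℕ
    K = count heavy

    light⇒degree≤2 : ∀ {u} → u ≢ w → heavy u ≡ false → degree G u ≤ 2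
    light⇒degree≤2 {u} u≢w hu with u ≟ w
    ... | yes u≡w = contradiction u≡w u≢w
    ... | no _    = m∸n≡0⇒m≤n (0≮ᵇ⇒≡0 hu)

    Light : Fin (suc m) → Fin (suc m) → Bool
    Light v u = not (does (u ≟ w)) ∧ adj G v u ∧ not (heavy u)

    light-neighbour : ∀ {v u} → v ≢ w → Light v u ≡ true → Adj G v u × degree G u ≡ 2 × u ≢ w
    light-neighbour {v} {u} v≢w e =
      vu , ≤-antisym (light⇒degree≤2 u≢w hu)
                     (two-neighbours⇒2≤degree G v≢w (Adj-sym G vu) (Adj-sym G (w-adj u≢w))) , u≢w
      where
      u≢w : u ≢ w
      u≢w u≡w = subst (λ b → not b ≢ true) (sym (dec-true (u ≟ w) u≡w)) (λ ())
                      (∧-conicalˡ (not (does (u ≟ w))) _ e)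
      vu : Adj G v u
      vu = ∧-conicalˡ _ (not (heavy u)) (∧-conicalʳ (not (does (u ≟ w))) _ e)
      hu : heavy u ≡ false
      hu = not-injective (∧-conicalʳ (adj G v u) _ (∧-conicalʳ (not (does (u ≟ w))) _ e))

    -- Two light neighbours i, j of v would be joined by the path i v w j.
    count-Light≤1 : ∀ {v} → v ≢ w → count (Light v) ≤ 1
    count-Light≤1 {v} v≢w = count-≤1 (Light v) unique
      where
      unique : ∀ i j → Light v i ≡ true → Light v j ≡ true → i ≡ j
      unique i j li lj with i ≟ j | light-neighbour v≢w li | light-neighbour v≢w lj
      ... | yes i≡j | _ | _ = i≡j
      ... | no i≢j | vi , di , i≢w | vj , dj , j≢w = contradiction
        (pathLen3 G i≢w i≢j (Adj⇒≢ G vj) (Adj-sym G vi) (Adj-sym G (w-adj v≢w)) (w-adj j≢w))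
        (no-P3 i j i≢j (trans di (sym dj)))

    heavyExcess-≢w : ∀ {u} → u ≢ w → heavyExcess u ≡ excess G u
    heavyExcess-≢w {u} u≢w with u ≟ w
    ... | yes u≡w = contradiction u≡w u≢w
    ... | no _    = refl

    positive⇒≢w : ∀ {u} → 0 < heavyExcess u → u ≢ w
    positive⇒≢w {u} pos with u ≟ w
    ... | no u≢w = u≢w

    heavyExcess-injectiveOnPositives : InjectiveOnPositives heavyExcess
    heavyExcess-injectiveOnPositives i j pos eq =
      excess-injectiveOnPositives G rep≤2 i j
        (subst (0 <_) (heavyExcess-≢w i≢w) pos)
        (trans (sym (heavyExcess-≢w i≢w)) (trans eq (heavyExcess-≢w j≢w)))
      where
      i≢w = positive⇒≢w pos
      j≢w = positive⇒≢w (subst (0 <_) eq pos)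

    -- Every neighbour of v is heavy, is w, or is a light neighbour of v.
    heavy-degree-≤ : ∀ {v} → heavy v ≡ true → degree G v ≤ suc K
    heavy-degree-≤ {v} hv = s≤s⁻¹ (begin
      suc (degree G v)                        ≡⟨ +-comm 1 (degree G v) ⟩
      degree G v + 1                          ≡⟨ cong (degree G v +_) (count-singleton v) ⟨
      degree G v + count (λ u → does (u ≟ v)) ≤⟨ degree+count-≤ G v neighbour-kinds ⟩
      ∑[ u < suc m ] (𝟙 (heavy u) + 𝟙 (does (u ≟ w)) + 𝟙 (Light v u))
        ≡⟨ ∑-distrib-+ (λ u → 𝟙 (heavy u) + 𝟙 (does (u ≟ w))) (λ u → 𝟙 (Light v u)) ⟩
      ∑[ u < suc m ] (𝟙 (heavy u) + 𝟙 (does (u ≟ w))) + count (Light v)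
        ≡⟨ cong (_+ count (Light v)) (∑-distrib-+ (λ u → 𝟙 (heavy u)) (λ u → 𝟙 (does (u ≟ w)))) ⟩
      K + count (λ u → does (u ≟ w)) + count (Light v)
        ≤⟨ +-mono-≤ (≤-reflexive (cong (K +_) (count-singleton w)))
                    (count-Light≤1 (positive⇒≢w (0<ᵇ⇒0< hv))) ⟩
      K + 1 + 1                               ≡⟨ trans (+-assoc K 1 1) (+-comm K 2) ⟩
      suc (suc K)                             ∎)
      where
      open ≤-Reasoning
      neighbour-kinds : ∀ u → 𝟙 (adj G v u) + 𝟙 (does (u ≟ v)) ≤
                              𝟙 (heavy u) + 𝟙 (does (u ≟ w)) + 𝟙 (Light v u)
      neighbour-kinds u with u ≟ v
      ... | yes refl rewrite irrefl G u | hv = s≤s z≤n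
      ... | no _     = ≤-trans (≤-reflexive (+-identityʳ _)) (𝟙-≤-cases (adj G v u) (heavy u) (does (u ≟ w)))

    -- The K heavy vertices have distinct excesses in {1, …, K - 1}.
    not-heavy : ∀ v → heavy v ≡ false
    not-heavy v with heavy v in hv
    ... | false = refl
    ... | true  = contradiction K≤K∸1 (<⇒≱ (∸-monoʳ-< z<s 1≤K))
      where
      1≤K : 1 ≤ K
      1≤K = begin
        1                            ≡⟨ count-singleton v ⟨
        count (λ u → does (u ≟ v))   ≤⟨ ∑-mono-≤ v-heavy ⟩
        K                            ∎
        where
        open ≤-Reasoning
        v-heavy : ∀ u → 𝟙 (does (u ≟ v)) ≤ 𝟙 (heavy u)
        v-heavy u with u ≟ v
        ... | yes refl rewrite hv = ≤-refl
        ... | no _     = z≤n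
      heavyExcess-≤ : ∀ u → heavyExcess u ≤ K ∸ 1
      heavyExcess-≤ u with heavy u in hu
      ... | true  = subst (_≤ K ∸ 1) (sym (heavyExcess-≢w (positive⇒≢w (0<ᵇ⇒0< hu))))
                          (∸-monoˡ-≤ 2 (heavy-degree-≤ hu))
      ... | false = subst (_≤ K ∸ 1) (sym (0≮ᵇ⇒≡0 hu)) z≤n
      K≤K∸1 : K ≤ K ∸ 1
      K≤K∸1 = subst (K ≤_) (sumTo-positive (K ∸ 1))
        (∑-injectiveOnPositives-≤ (λ k → 𝟙 (0 <ᵇ k)) refl (K ∸ 1) heavyExcess
           heavyExcess-≤ heavyExcess-injectiveOnPositives)

  ∑degree-≤-dominating : ∑[ u < suc m ] degree G u ≤ m + m * 2
  ∑degree-≤-dominating = begin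
    ∑[ u < suc m ] degree G u                      ≡⟨ sum-remove {i = w} (degree G) ⟩
    degree G w + ∑[ j < m ] degree G (punchIn w j) ≤⟨ +-mono-≤ (≤-reflexive w-dominating) (∑-mono-≤ others≤2) ⟩
    m + ∑[ j < m ] 2                               ≡⟨ cong (m +_) (∑-const m 2) ⟩
    m + m * 2                                      ∎
    where
    open ≤-Reasoning
    others≤2 : ∀ j → degree G (punchIn w j) ≤ 2
    others≤2 j = light⇒degree≤2 (punchInᵢ≢i w j) (not-heavy (punchIn w j))

2[3+k]∸1 : ∀ k → 2 * (3 + k) ∸ 1 ≡ 5 + 2 * k
2[3+k]∸1 k = normal-form k
  where
  -- The solver does not handle ∸, so the left-hand side is given in the form it evaluates to.
  normal-form : ∀ k → 2 + (k + (3 + (k + 0))) ≡ 5 + 2 * k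
  normal-form = solve-∀

[3+k]²∸1 : ∀ k → (3 + k) * (3 + k) ∸ 1 ≡ 8 + (6 * k + k * k)
[3+k]²∸1 k = cong (_∸ 1) (square k)
  where
  square : ∀ k → (3 + k) * (3 + k) ≡ 9 + (6 * k + k * k)
  square = solve-∀

half-< : ∀ {a b} → a + a < b + b → a < b
half-< a+a<b+b = ≰⇒> (λ b≤a → <⇒≱ a+a<b+b (+-mono-≤ b≤a b≤a))

dominating-arith : ∀ k E → E + E ≤ (2 * (3 + k) ∸ 1) + (2 * (3 + k) ∸ 1) * 2 →
                   E < (3 + k) * (3 + k) ∸ 1
dominating-arith k E 2E≤ = half-< (begin-strict
  E + E                                   ≤⟨ 2E≤ ⟩
  (2 * (3 + k) ∸ 1) + (2 * (3 + k) ∸ 1) * 2 ≡⟨ cong (λ m → m + m * 2) (2[3+k]∸1 k) ⟩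
  (5 + 2 * k) + (5 + 2 * k) * 2           <⟨ s≤s (m≤m+n _ (6 * k + 2 * (k * k))) ⟩
  suc ((5 + 2 * k) + (5 + 2 * k) * 2) + (6 * k + 2 * (k * k)) ≡⟨ gap k ⟩
  (8 + (6 * k + k * k)) + (8 + (6 * k + k * k)) ≡⟨ cong (λ x → x + x) ([3+k]²∸1 k) ⟨
  ((3 + k) * (3 + k) ∸ 1) + ((3 + k) * (3 + k) ∸ 1) ∎)
  where
  open ≤-Reasoning
  gap : ∀ k → suc ((5 + 2 * k) + (5 + 2 * k) * 2) + (6 * k + 2 * (k * k)) ≡
              (8 + (6 * k + k * k)) + (8 + (6 * k + k * k))
  gap = solve-∀

maxDegree-arith : ∀ k E → E + E ≤ 2 * (3 + k) * 2 + sumTo (λ i → i) (2 + 2 * k) →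
                  E < (3 + k) * (3 + k) ∸ 1
maxDegree-arith k E 2E≤ = half-< (*-cancelˡ-< 2 _ _ (begin-strict
  2 * (E + E)                                               ≤⟨ *-monoʳ-≤ 2 2E≤ ⟩
  2 * (2 * (3 + k) * 2 + sumTo (λ i → i) (2 + 2 * k))        ≡⟨ *-distribˡ-+ 2 (2 * (3 + k) * 2) _ ⟩
  2 * (2 * (3 + k) * 2) + 2 * sumTo (λ i → i) (2 + 2 * k)    ≡⟨ cong (2 * (2 * (3 + k) * 2) +_) (*-sumTo-id (2 + 2 * k)) ⟩
  2 * (2 * (3 + k) * 2) + (2 + 2 * k) * (3 + 2 * k)         <⟨ s≤s (m≤m+n _ (6 * k + 1)) ⟩
  suc (2 * (2 * (3 + k) * 2) + (2 + 2 * k) * (3 + 2 * k)) + (6 * k + 1) ≡⟨ gap k ⟩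
  2 * ((8 + (6 * k + k * k)) + (8 + (6 * k + k * k)))       ≡⟨ cong (λ x → 2 * (x + x)) ([3+k]²∸1 k) ⟨
  2 * (((3 + k) * (3 + k) ∸ 1) + ((3 + k) * (3 + k) ∸ 1))   ∎))
  where
  open ≤-Reasoning
  gap : ∀ k → suc (2 * (2 * (3 + k) * 2) + (2 + 2 * k) * (3 + 2 * k)) + (6 * k + 1) ≡
              2 * ((8 + (6 * k + k * k)) + (8 + (6 * k + k * k)))
  gap = solve-∀

few-edges : ∀ k (G : Graph (2 * (3 + k))) → NoEqualDegreeP3 G → RepeatedDegreesAtMost G 2 →
            edgeCount G < (3 + k) * (3 + k) ∸ 1
few-edges k G no-P3 rep≤2 with any? (λ w → degree G w ≟ℕ 2 * (3 + k) ∸ 1)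
... | yes (w , w-dominating) = dominating-arith k (edgeCount G)
  (≤-trans (≤-reflexive (sym (handshake G))) (∑degree-≤-dominating G no-P3 rep≤2 w w-dominating))
... | no no-dominating = maxDegree-arith k (edgeCount G)
  (≤-trans (≤-reflexive (sym (handshake G))) (∑degree-≤-maxDegree G rep≤2 (2 + 2 * k) degree-≤))
  where
  degree-≤ : ∀ u → degree G u ≤ 2 + (2 + 2 * k)
  degree-≤ u = s≤s⁻¹ (subst (degree G u <_) (2[3+k]∸1 k)
                 (≤∧≢⇒< (s≤s⁻¹ (degree<order G u)) (λ full → no-dominating (u , full))))

lemma3p2 : (n : ℕ) → 3 ≤ n → (G : Graph (2 * n)) →
    n * n ∸ 1 ≤ edgeCount G → NoEqualDegreeP3 G →
    (β Δ : ℕ) → IsLargestRepeatedDegree G β → IsMaxDegree G Δ →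
    (3 ≤ β) × (β ≤ Δ)
lemma3p2 (suc (suc (suc k))) (s≤s (s≤s (s≤s z≤n))) G many-edges no-P3 β Δ
         ((u , _ , _ , du≡β , _) , β-largest) (_ , Δ-max) =
  3≤β , subst (_≤ Δ) du≡β (Δ-max u)
  where
  3≤β : 3 ≤ β
  3≤β with 3 ≤? β
  ... | yes 3≤β = 3≤β
  ... | no  3≰β = contradiction many-edges (<⇒≱ (few-edges k G no-P3 rep≤2))
    where
    rep≤2 : RepeatedDegreesAtMost G 2
    rep≤2 x y x≢y dx≡dy = ≤-trans (β-largest _ (x , y , x≢y , refl , sym dx≡dy)) (s≤s⁻¹ (≰⇒> 3≰β))
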